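{- Let $G=(V,E)$ be a graph. The star inequalities $$x(W)+(|W|-1)x_w\le |W|\qquad\text{for all } w\in V \text{ and } W\subseteq N(w)$$ are valid for $\mathcal{P}(G)$. Moreover, if $G$ is a tree, each of these inequalities defines a facet of $\mathcal{P}(G)$.
   Context: $N(w)$ denotes the set of neighbours of $w$; $x(W)=\sum_{u\in W}x_u$. A co-2-plex of $G$ is a vertex set inducing a subgraph of maximum degree at most $1$; $\mathcal{P}(G)\subseteq\mathbb{R}^V$ is the convex hull of incidence vectors of co-2-plexes of $G$. A tree is a connected graph with no cycle.
   Formalization: The polytope $\mathcal{P}(G)$ is taken in ℚ^V instead of ℝ^V, as the set of rational convex combinations of co-2-plex incidence vectors, and affine independence, hence facet dimension, is taken over ℚ. -}

module Defs where

open import Data.Nat using (ℕ; zero; suc) renaming (_≤_ to _≤ℕ_)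
open import Data.Bool using (Bool; true; false; _∧_; if_then_else_)
open import Data.Fin using (Fin; zero; suc; inject₁; fromℕ)
open import Data.Fin.Subset using (Subset; _∈_; _∩_; ∣_∣)
open import Data.Vec using (tabulate; lookup)
open import Data.Rational using (ℚ; 0ℚ; 1ℚ; _+_; _*_; _-_; _≤_)
open import Data.Rational as ℚ using ()
import Data.Integer as ℤ
open import Data.Product using (Σ; ∃; _×_; _,_)
open import Data.List using (List; []; _∷_)
open import Data.List.Relation.Unary.All using (All)
open import Data.Empty using (⊥)
open import Relation.Nullary using (¬_)
open import Relation.Nullary.Decidable using (isYes)
import Data.Fin as Fin
open import Relation.Binary.PropositionalEquality using (_≡_)
open import Function.Definitions using (Injective)

record Graph (n : ℕ) : Set where
  field
    adj   : Fin n → Fin n → Bool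
    sym   : ∀ u v → adj u v ≡ adj v u
    irrefl : ∀ v → adj v v ≡ false
open Graph public

N : ∀ {n} → Graph n → Fin n → Subset n
N G w = tabulate (adj G w)

IsCo2Plex : ∀ {n} → Graph n → Subset n → Set
IsCo2Plex G S = ∀ v → v ∈ S → ∣ S ∩ N G v ∣ ≤ℕ 1

Point : ℕ → Set
Point n = Fin n → ℚ

sumFin : ∀ {k} → (Fin k → ℚ) → ℚ
sumFin {zero}  f = 0ℚ
sumFin {suc k} f = f zero + sumFin (λ i → f (suc i))

χ : ∀ {n} → Subset n → Point n
χ S u = if lookup S u then 1ℚ else 0ℚ

xOf : ∀ {n} → Point n → Subset n → ℚ
xOf x W = sumFin (λ u → x u * χ W u)

card : ∀ {n} → Subset n → ℚ
card W = ℤ.+ ∣ W ∣ ℚ./ 1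

-- P(G): convex hull (over ℚ) of incidence vectors of co-2-plexes of G.
InP : ∀ {n} → Graph n → Point n → Set
InP {n} G x =
  Σ ℕ λ m → Σ (Fin m → ℚ) λ c → Σ (Fin m → Subset n) λ S →
    (∀ i → 0ℚ ≤ c i) × (sumFin c ≡ 1ℚ) × (∀ i → IsCo2Plex G (S i)) ×
    (∀ u → x u ≡ sumFin (λ i → c i * χ (S i) u))

AffinelyIndependent : ∀ {n k} → (Fin (suc k) → Point n) → Set
AffinelyIndependent {n} {k} p =
  ∀ (c : Fin (suc k) → ℚ) → sumFin c ≡ 0ℚ →
    (∀ u → sumFin (λ i → c i * p i u) ≡ 0ℚ) → ∀ i → c i ≡ 0ℚ

HasAffIndep : ∀ {n} → (Point n → Set) → ℕ → Set
HasAffIndep {n} X d =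
  Σ (Fin (suc d) → Point n) λ p → (∀ i → X (p i)) × AffinelyIndependent p

HasDim : ∀ {n} → (Point n → Set) → ℕ → Set
HasDim X d = HasAffIndep X d × ¬ HasAffIndep X (suc d)

dot : ∀ {n} → Point n → Point n → ℚ
dot a x = sumFin (λ u → a u * x u)

Valid : ∀ {n} → (Point n → Set) → Point n → ℚ → Set
Valid X a b = ∀ x → X x → dot a x ≤ b

DefinesFacet : ∀ {n} → (Point n → Set) → Point n → ℚ → Set
DefinesFacet X a b =
  Valid X a b × Σ ℕ λ d → HasDim X (suc d) × HasDim (λ x → X x × dot a x ≡ b) d

-- Coefficient vector of the star inequality x(W) + (|W|−1) x_w ≤ |W|.
starCoeff : ∀ {n} → Subset n → Fin n → Point n
starCoeff W w u = χ W u + (if isYes (u Fin.≟ w) then card W - 1ℚ else 0ℚ)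

Walk : ∀ {n} → Graph n → ∀ {m} → (Fin (suc m) → Fin n) → Set
Walk G {m} p = ∀ (i : Fin m) → adj G (p (inject₁ i)) (p (suc i)) ≡ true

Connected : ∀ {n} → Graph n → Set
Connected {n} G = ∀ (u v : Fin n) →
  Σ ℕ λ m → Σ (Fin (suc m) → Fin n) λ p →
    Walk G p × p zero ≡ u × p (fromℕ m) ≡ v

HasCycle : ∀ {n} → Graph n → Set
HasCycle {n} G = Σ ℕ λ m → Σ (Fin (suc (suc (suc m))) → Fin n) λ c →
  Injective _≡_ _≡_ c × Walk G c × adj G (c (fromℕ (suc (suc m)))) (c zero) ≡ true

IsTree : ∀ {n} → Graph n → Set
IsTree G = Connected G × ¬ HasCycle G

module Submission where

-- A co-2-plex S containing w meets N(w), hence W, in at most one vertex, so the star inequality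
-- gives at most 1 + (|W| - 1); if w ∉ S the left side is |S ∩ W| ≤ |W|.  Averaging extends this
-- to the convex hull.  For the facet, the empty set and the singletons show that P(G) is
-- full-dimensional, and in a forest the n sets W, {w, v} (v ∈ W) and W ∪ {v} (v ∉ W ∪ {w}) are
-- co-2-plexes (only a triangle or a 4-cycle through w could spoil this) that attain equality and
-- are affinely independent.  The dimension upper bounds are Gaussian elimination over ℚ: more
-- vectors than coordinates are linearly dependent.

open import Defs hiding (sym)
open import Data.Bool using (true; false; if_then_else_)
open import Data.Empty using (⊥-elim)
open import Data.Fin using (Fin; zero; suc; punchIn; punchOut)
import Data.Fin as Fin
open import Data.Fin.Properties using (all?; ¬∀⟶∃¬; suc-injective; punchIn-punchOut)
open import Data.Fin.Subset using (Subset; _∈_; _∉_; _⊆_; _∩_; _∪_; ⁅_⁆; ∣_∣)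
  renaming (⊥ to ∅)
open import Data.Fin.Subset.Properties
  using (_∈?_; nonempty?; Empty-unique; ∉⊥; ∣⊥∣≡0; x∈⁅x⁆; x∈⁅y⁆⇒x≡y; x≢y⇒x∉⁅y⁆; ∣⁅x⁆∣≡1; p⊆q⇒∣p∣≤∣q∣; ∣p∩q∣≤∣q∣; x∈p∩q⁺; x∈p∩q⁻;
         x∈p∪q⁺; x∈p∪q⁻; ⊆-antisym; ∩-idem; ∩-comm; ∩-abs-∪)
open import Data.Nat using (ℕ; zero; suc; s≤s; _<_)
import Data.Nat as ℕ
import Data.Nat.Properties as ℕ
open import Data.Nat.Coprimality using (1-coprimeTo)
import Data.Nat.Coprimality as Coprime
open import Data.Product using (Σ; ∃; _×_; _,_; proj₁; proj₂)
open import Data.Sum using (_⊎_; inj₁; inj₂)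
import Data.Integer as ℤ
import Data.Integer.Properties as ℤ
open import Data.Rational using (ℚ; nonNegative; mkℚ; 0ℚ; 1ℚ; _+_; _*_; _-_; -_; _/_; 1/_; NonZero; ≢-nonZero; _≤_; *≤*)
open import Data.Rational.Properties
open import Data.Rational.Solver using (module +-*-Solver)
open import Data.Vec using ([]; _∷_; lookup)
open import Data.Vec.Relation.Unary.Unique.Propositional using (Unique)
open import Data.Vec.Relation.Unary.Unique.Propositional.Properties using (lookup-injective)
open import Data.Vec.Relation.Unary.AllPairs using ([]; _∷_)
open import Data.Vec.Relation.Unary.All using ([]; _∷_)
open import Data.Vec.Properties using ([]=⇒lookup; lookup⇒[]=; lookup∘tabulate)
open import Data.Vec.Functional using (insertAt)
open import Data.Vec.Functional.Properties using (insertAt-lookup; insertAt-punchIn)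
open import Relation.Binary.PropositionalEquality
open import Relation.Nullary using (¬_; yes; no)
open import Relation.Nullary.Decidable using (isYes)
open import Function using (_∘_; case_of_)

open +-*-Solver using (solve; _:+_; _:*_; _:-_; :-_; _:=_; con)

fromℕ : ℕ → ℚ
fromℕ k = mkℚ (ℤ.+ k) 0 (Coprime.sym (1-coprimeTo k))

+k/1≡fromℕ : ∀ k → ℤ.+ k / 1 ≡ fromℕ k
+k/1≡fromℕ k = normalize-coprime (Coprime.sym (1-coprimeTo k))

fromℕ-suc : ∀ k → 1ℚ + fromℕ k ≡ fromℕ (suc k)
fromℕ-suc k = trans (cong (λ z → (ℤ.+ 1 ℤ.+ z) / 1) (ℤ.*-identityʳ (ℤ.+ k))) (+k/1≡fromℕ (suc k))

fromℕ-mono-≤ : ∀ {k l} → k ℕ.≤ l → fromℕ k ≤ fromℕ l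
fromℕ-mono-≤ {k} {l} k≤l = *≤* (subst₂ ℤ._≤_ (sym (ℤ.*-identityʳ (ℤ.+ k))) (sym (ℤ.*-identityʳ (ℤ.+ l))) (ℤ.+≤+ k≤l))

*-cancelˡ-≡0 : ∀ {a x} → a ≢ 0ℚ → a * x ≡ 0ℚ → x ≡ 0ℚ
*-cancelˡ-≡0 {a} {x} a≢0 ax≡0 = begin
  x                 ≡⟨ sym (*-identityˡ x) ⟩
  1ℚ * x            ≡⟨ cong (_* x) (sym (*-inverseˡ a)) ⟩
  (1/ a) * a * x    ≡⟨ *-assoc (1/ a) a x ⟩
  (1/ a) * (a * x)  ≡⟨ cong ((1/ a) *_) ax≡0 ⟩
  (1/ a) * 0ℚ       ≡⟨ *-zeroʳ (1/ a) ⟩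
  0ℚ                ∎
  where
  open ≡-Reasoning
  instance a-nonZero : NonZero a
  a-nonZero = ≢-nonZero a≢0

*-≢0 : ∀ {a b} → a ≢ 0ℚ → b ≢ 0ℚ → a * b ≢ 0ℚ
*-≢0 a≢0 b≢0 ab≡0 = b≢0 (*-cancelˡ-≡0 a≢0 ab≡0)

sumFin-cong : ∀ {k} {f g : Fin k → ℚ} → (∀ i → f i ≡ g i) → sumFin f ≡ sumFin g
sumFin-cong {zero}  f≗g = refl
sumFin-cong {suc k} f≗g = cong₂ _+_ (f≗g zero) (sumFin-cong (λ i → f≗g (suc i)))

sumFin-zero : ∀ {k} (f : Fin k → ℚ) → (∀ i → f i ≡ 0ℚ) → sumFin f ≡ 0ℚ
sumFin-zero {zero}  f f≡0 = refl
sumFin-zero {suc k} f f≡0 = cong₂ _+_ (f≡0 zero) (sumFin-zero (λ i → f (suc i)) (λ i → f≡0 (suc i)))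

sumFin-+ : ∀ {k} (f g : Fin k → ℚ) → sumFin (λ i → f i + g i) ≡ sumFin f + sumFin g
sumFin-+ {zero}  f g = refl
sumFin-+ {suc k} f g = trans (cong (f zero + g zero +_) (sumFin-+ (λ i → f (suc i)) (λ i → g (suc i))))
  (solve 4 (λ a b c d → (a :+ b) :+ (c :+ d) := (a :+ c) :+ (b :+ d)) refl (f zero) (g zero) _ _)

sumFin-*ˡ : ∀ {k} (r : ℚ) (f : Fin k → ℚ) → sumFin (λ i → r * f i) ≡ r * sumFin f
sumFin-*ˡ {zero}  r f = sym (*-zeroʳ r)
sumFin-*ˡ {suc k} r f = trans (cong (r * f zero +_) (sumFin-*ˡ r (λ i → f (suc i))))
  (sym (*-distribˡ-+ r (f zero) _))

sumFin-*ʳ : ∀ {k} (r : ℚ) (f : Fin k → ℚ) → sumFin (λ i → f i * r) ≡ sumFin f * r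
sumFin-*ʳ r f = trans (sumFin-cong (λ i → *-comm (f i) r)) (trans (sumFin-*ˡ r f) (*-comm r (sumFin f)))

sumFin-comm : ∀ {k l} (f : Fin k → Fin l → ℚ) →
  sumFin (λ i → sumFin (f i)) ≡ sumFin (λ j → sumFin (λ i → f i j))
sumFin-comm {zero} {l} f = sym (sumFin-zero {l} _ (λ _ → refl))
sumFin-comm {suc k} f = trans (cong (sumFin (f zero) +_) (sumFin-comm (λ i → f (suc i))))
  (sym (sumFin-+ (f zero) (λ j → sumFin (λ i → f (suc i) j))))

sumFin-single : ∀ {k} (f : Fin k → ℚ) (j : Fin k) → (∀ i → i ≢ j → f i ≡ 0ℚ) → sumFin f ≡ f j
sumFin-single {suc k} f zero    f≡0 =
  trans (cong (f zero +_) (sumFin-zero _ (λ i → f≡0 (suc i) λ ()))) (+-identityʳ (f zero))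
sumFin-single {suc k} f (suc j) f≡0 =
  trans (cong₂ _+_ (f≡0 zero λ ()) (sumFin-single (λ i → f (suc i)) j (λ i i≢j → f≡0 (suc i) (i≢j ∘ suc-injective))))
    (+-identityˡ (f (suc j)))

sumFin-punchIn : ∀ {k} (f : Fin (suc k) → ℚ) (j : Fin (suc k)) →
  sumFin f ≡ f j + sumFin (λ i → f (punchIn j i))
sumFin-punchIn     f zero    = refl
sumFin-punchIn {suc k} f (suc j) = trans (cong (f zero +_) (sumFin-punchIn (λ i → f (suc i)) j))
  (solve 3 (λ a b c → a :+ (b :+ c) := b :+ (a :+ c)) refl (f zero) (f (suc j)) _)

sumFin-mono-≤ : ∀ {k} {f g : Fin k → ℚ} → (∀ i → f i ≤ g i) → sumFin f ≤ sumFin g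
sumFin-mono-≤ {zero}  f≤g = ≤-refl
sumFin-mono-≤ {suc k} f≤g = +-mono-≤ (f≤g zero) (sumFin-mono-≤ (λ i → f≤g (suc i)))

isolated-coefficient≡0 : ∀ {k} (c f : Fin k → ℚ) (j : Fin k) → sumFin (λ i → c i * f i) ≡ 0ℚ →
  f j ≡ 1ℚ → (∀ i → i ≢ j → c i * f i ≡ 0ℚ) → c j ≡ 0ℚ
isolated-coefficient≡0 c f j Σ≡0 fⱼ≡1 others≡0 = begin
  c j           ≡⟨ sym (*-identityʳ (c j)) ⟩
  c j * 1ℚ      ≡⟨ cong (c j *_) (sym fⱼ≡1) ⟩
  c j * f j     ≡⟨ sym (sumFin-single (λ i → c i * f i) j others≡0) ⟩
  sumFin (λ i → c i * f i) ≡⟨ Σ≡0 ⟩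
  0ℚ            ∎
  where open ≡-Reasoning

combination : ∀ {k m} → (Fin k → ℚ) → (Fin k → Point m) → Point m
combination c v u = sumFin (λ i → c i * v i u)

LinearlyDependent : ∀ {k m} → (Fin k → Point m) → Set
LinearlyDependent {k} v = Σ (Fin k → ℚ) λ c → (∀ u → combination c v u ≡ 0ℚ) × ∃ λ j → c j ≢ 0ℚ

dependent-of-zero-head : ∀ {k m} (v : Fin k → Point (suc m)) → (∀ i → v i zero ≡ 0ℚ) →
  LinearlyDependent (λ i u → v i (suc u)) → LinearlyDependent v
dependent-of-zero-head v head≡0 (c , rel , nontrivial) = c , rel′ , nontrivial
  where
  rel′ : ∀ u → combination c v u ≡ 0ℚ
  rel′ zero    = sumFin-zero _ (λ i → trans (cong (c i *_) (head≡0 i)) (*-zeroʳ (c i)))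
  rel′ (suc u) = rel u

-- Division-free elimination of the first coordinate against the pivot vector v j.
eliminate : ∀ {k m} → (Fin (suc k) → Point (suc m)) → Fin (suc k) → Fin k → Point m
eliminate v j i u = v j zero * v (punchIn j i) (suc u) - v (punchIn j i) zero * v j (suc u)

module _ {k m} (v : Fin (suc k) → Point (suc m)) (j : Fin (suc k)) (d : Fin k → ℚ) where

  private
    a : ℚ
    a = v j zero

    y : Fin k → Point (suc m)
    y i = v (punchIn j i)

  liftRelation : Fin (suc k) → ℚ
  liftRelation = insertAt (λ i → a * d i) j (- sumFin (λ i → d i * y i zero))

  combination-liftRelation : ∀ u →
    combination liftRelation v u ≡ sumFin (λ i → d i * (a * y i u - y i zero * v j u))
  combination-liftRelation u = begin
    combination liftRelation v u
      ≡⟨ sumFin-punchIn (λ x → liftRelation x * v x u) j ⟩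
    liftRelation j * v j u + sumFin (λ i → liftRelation (punchIn j i) * y i u)
      ≡⟨ cong₂ _+_ (cong (_* v j u) (insertAt-lookup _ j _))
                   (sumFin-cong (λ i → cong (_* y i u) (insertAt-punchIn _ j _ i))) ⟩
    - S * z + sumFin (λ i → (a * d i) * y i u)
      ≡⟨ cong (_+ T) (solve 2 (λ S z → :- S :* z := S :* (:- z)) refl S z) ⟩
    S * - z + sumFin (λ i → (a * d i) * y i u)
      ≡⟨ cong (_+ T) (sym (sumFin-*ʳ (- z) (λ i → d i * y i zero))) ⟩
    sumFin (λ i → d i * y i zero * - z) + sumFin (λ i → (a * d i) * y i u)
      ≡⟨ sym (sumFin-+ (λ i → d i * y i zero * - z) (λ i → (a * d i) * y i u)) ⟩
    sumFin (λ i → d i * y i zero * - z + (a * d i) * y i u)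
      ≡⟨ sumFin-cong (λ i → solve 5 (λ d y₀ z a yᵤ → d :* y₀ :* (:- z) :+ (a :* d) :* yᵤ := d :* (a :* yᵤ :- y₀ :* z))
                                  refl (d i) (y i zero) z a (y i u)) ⟩
    sumFin (λ i → d i * (a * y i u - y i zero * z)) ∎
    where
    open ≡-Reasoning
    S = sumFin (λ i → d i * y i zero)
    z = v j u
    T = sumFin (λ i → (a * d i) * y i u)

dependent-by-elimination : ∀ {k m} (v : Fin (suc k) → Point (suc m)) (j : Fin (suc k)) → v j zero ≢ 0ℚ →
  LinearlyDependent (eliminate v j) → LinearlyDependent v
dependent-by-elimination v j a≢0 (d , rel , j′ , d≢0) = liftRelation v j d , rel′ , punchIn j j′ , nontrivial
  where
  rel′ : ∀ u → combination (liftRelation v j d) v u ≡ 0ℚ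
  rel′ zero    = trans (combination-liftRelation v j d zero) (sumFin-zero _ λ i →
    solve 3 (λ d a y₀ → d :* (a :* y₀ :- y₀ :* a) := con 0ℚ) refl (d i) (v j zero) (v (punchIn j i) zero))
  rel′ (suc u) = trans (combination-liftRelation v j d (suc u)) (rel u)
  nontrivial : liftRelation v j d (punchIn j j′) ≢ 0ℚ
  nontrivial rewrite insertAt-punchIn (λ i → v j zero * d i) j (- sumFin (λ i → d i * v (punchIn j i) zero)) j′ =
    *-≢0 a≢0 d≢0

linearlyDependent : ∀ {k m} → m < k → (v : Fin k → Point m) → LinearlyDependent v
linearlyDependent {suc k} {zero}  _          v = (λ _ → 1ℚ) , (λ ()) , zero , 1≢0
linearlyDependent {suc k} {suc m} (s≤s m<k) v with all? (λ i → v i zero ≟ 0ℚ)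
... | yes head≡0 = dependent-of-zero-head v head≡0 (linearlyDependent (ℕ.m<n⇒m<1+n m<k) (λ i u → v i (suc u)))
... | no ¬head≡0 with ¬∀⟶∃¬ _ _ (λ i → v i zero ≟ 0ℚ) ¬head≡0
...   | j , pivot≢0 = dependent-by-elimination v j pivot≢0 (linearlyDependent m<k (eliminate v j))

homogenize : ∀ {n} → Point n → Point (suc n)
homogenize x zero    = 1ℚ
homogenize x (suc u) = x u

combination-homogenize-zero : ∀ {k n} (c : Fin k → ℚ) (p : Fin k → Point n) →
  combination c (homogenize ∘ p) zero ≡ sumFin c
combination-homogenize-zero c p = sumFin-cong (λ i → *-identityʳ (c i))

dependent⇒¬affinelyIndependent : ∀ {k n} (p : Fin (suc k) → Point n) →
  LinearlyDependent (homogenize ∘ p) → ¬ AffinelyIndependent p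
dependent⇒¬affinelyIndependent p (c , rel , j , c≢0) indep =
  c≢0 (indep c (trans (sym (combination-homogenize-zero c p)) (rel zero)) (rel ∘ suc) j)

¬affinelyIndependent-2+n : ∀ {n} (p : Fin (suc (suc n)) → Point n) → ¬ AffinelyIndependent p
¬affinelyIndependent-2+n {n} p =
  dependent⇒¬affinelyIndependent p (linearlyDependent (ℕ.n<1+n (suc n)) (homogenize ∘ p))

dot-combination : ∀ {k n} (a : Point n) (c : Fin k → ℚ) (p : Fin k → Point n) →
  dot a (combination c p) ≡ sumFin (λ i → c i * dot a (p i))
dot-combination a c p = begin
  sumFin (λ u → a u * sumFin (λ i → c i * p i u))
    ≡⟨ sumFin-cong (λ u → sym (sumFin-*ˡ (a u) (λ i → c i * p i u))) ⟩
  sumFin (λ u → sumFin (λ i → a u * (c i * p i u)))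
    ≡⟨ sumFin-cong (λ u → sumFin-cong (λ i → *-left-commutative (a u) (c i) (p i u))) ⟩
  sumFin (λ u → sumFin (λ i → c i * (a u * p i u)))
    ≡⟨ sumFin-comm (λ u i → c i * (a u * p i u)) ⟩
  sumFin (λ i → sumFin (λ u → c i * (a u * p i u)))
    ≡⟨ sumFin-cong (λ i → sumFin-*ˡ (c i) (λ u → a u * p i u)) ⟩
  sumFin (λ i → c i * dot a (p i)) ∎
  where
  open ≡-Reasoning
  *-left-commutative : ∀ x y z → x * (y * z) ≡ y * (x * z)
  *-left-commutative = solve 3 (λ x y z → x :* (y :* z) := y :* (x :* z)) refl

-- On the hyperplane the pivot coordinate is an affine function of the others, so an affine
-- relation among the other coordinates also holds at the pivot.
relation-extends-over-pivot : ∀ {k n} (a : Point (suc n)) (b : ℚ) (j : Fin (suc n)) → a j ≢ 0ℚ →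
  (p : Fin k → Point (suc n)) → (∀ i → dot a (p i) ≡ b) → (c : Fin k → ℚ) → sumFin c ≡ 0ℚ →
  (∀ u → combination c p (punchIn j u) ≡ 0ℚ) → ∀ u → combination c p u ≡ 0ℚ
relation-extends-over-pivot a b j aⱼ≢0 p on-hyperplane c Σc≡0 rel u with j Fin.≟ u
... | no j≢u   = subst (λ u → combination c p u ≡ 0ℚ) (punchIn-punchOut j≢u) (rel (punchOut j≢u))
... | yes refl = *-cancelˡ-≡0 aⱼ≢0 (begin
  a j * combination c p j
    ≡⟨ sym (+-identityʳ _) ⟩
  a j * combination c p j + 0ℚ
    ≡⟨ cong (a j * combination c p j +_) (sym (sumFin-zero _ λ u →
         trans (cong (a (punchIn j u) *_) (rel u)) (*-zeroʳ (a (punchIn j u))))) ⟩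
  a j * combination c p j + sumFin (λ u → a (punchIn j u) * combination c p (punchIn j u))
    ≡⟨ sym (sumFin-punchIn (λ u → a u * combination c p u) j) ⟩
  dot a (combination c p)
    ≡⟨ dot-combination a c p ⟩
  sumFin (λ i → c i * dot a (p i))
    ≡⟨ sumFin-cong (λ i → cong (c i *_) (on-hyperplane i)) ⟩
  sumFin (λ i → c i * b)
    ≡⟨ sumFin-*ʳ b c ⟩
  sumFin c * b
    ≡⟨ cong (_* b) Σc≡0 ⟩
  0ℚ * b
    ≡⟨ *-zeroˡ b ⟩
  0ℚ ∎)
  where open ≡-Reasoning

¬affinelyIndependent-on-hyperplane : ∀ {n} (a : Point (suc n)) (b : ℚ) (j : Fin (suc n)) → a j ≢ 0ℚ →
  (p : Fin (suc (suc n)) → Point (suc n)) → (∀ i → dot a (p i) ≡ b) → ¬ AffinelyIndependent p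
¬affinelyIndependent-on-hyperplane {n} a b j aⱼ≢0 p on-hyperplane indep
  with linearlyDependent (ℕ.n<1+n (suc n)) (λ i → homogenize (λ u → p i (punchIn j u)))
... | c , rel , i , cᵢ≢0 = cᵢ≢0 (indep c Σc≡0 (relation-extends-over-pivot a b j aⱼ≢0 p on-hyperplane c Σc≡0 (rel ∘ suc)) i)
  where
  Σc≡0 : sumFin c ≡ 0ℚ
  Σc≡0 = trans (sym (combination-homogenize-zero c (λ i u → p i (punchIn j u)))) (rel zero)

hasDim-full : ∀ {n} {X : Point n → Set} → HasAffIndep X n → HasDim X n
hasDim-full indep = indep , λ (p , _ , p-indep) → ¬affinelyIndependent-2+n p p-indep

hasDim-hyperplane : ∀ {n} {X : Point (suc n) → Set} (a : Point (suc n)) (b : ℚ) (j : Fin (suc n)) →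
  a j ≢ 0ℚ → (∀ x → X x → dot a x ≡ b) → HasAffIndep X n → HasDim X n
hasDim-hyperplane a b j aⱼ≢0 X⊆H indep = indep , λ (p , p∈X , p-indep) →
  ¬affinelyIndependent-on-hyperplane a b j aⱼ≢0 p (λ i → X⊆H (p i) (p∈X i)) p-indep

χ-∈ : ∀ {n} {S : Subset n} {u} → u ∈ S → χ S u ≡ 1ℚ
χ-∈ u∈S rewrite []=⇒lookup u∈S = refl

χ-∉ : ∀ {n} {S : Subset n} {u} → u ∉ S → χ S u ≡ 0ℚ
χ-∉ {S = S} {u} u∉S with lookup S u in eq
... | true  = ⊥-elim (u∉S (lookup⇒[]= u S eq))
... | false = refl

χ-∩ : ∀ {n} (S T : Subset n) u → χ S u * χ T u ≡ χ (S ∩ T) u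
χ-∩ (true  ∷ S) (true  ∷ T) zero    = *-identityˡ 1ℚ
χ-∩ (true  ∷ S) (false ∷ T) zero    = *-identityˡ 0ℚ
χ-∩ (false ∷ S) (t     ∷ T) zero    = *-zeroˡ (χ (t ∷ T) zero)
χ-∩ (s     ∷ S) (t     ∷ T) (suc u) = χ-∩ S T u

sumFin-χ : ∀ {n} (S : Subset n) → sumFin (χ S) ≡ fromℕ ∣ S ∣
sumFin-χ []          = refl
sumFin-χ (true  ∷ S) = trans (cong (1ℚ +_) (sumFin-χ S)) (fromℕ-suc ∣ S ∣)
sumFin-χ (false ∷ S) = trans (+-identityˡ _) (sumFin-χ S)

xOf-χ : ∀ {n} (S W : Subset n) → xOf (χ S) W ≡ fromℕ ∣ S ∩ W ∣
xOf-χ S W = trans (sumFin-cong (χ-∩ S W)) (sumFin-χ (S ∩ W))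

∈pair : ∀ {n} {a b u : Fin n} → u ∈ ⁅ a ⁆ ∪ ⁅ b ⁆ → u ≡ a ⊎ u ≡ b
∈pair {a = a} {b} u∈ with x∈p∪q⁻ ⁅ a ⁆ ⁅ b ⁆ u∈
... | inj₁ u∈⁅a⁆ = inj₁ (x∈⁅y⁆⇒x≡y a u∈⁅a⁆)
... | inj₂ u∈⁅b⁆ = inj₂ (x∈⁅y⁆⇒x≡y b u∈⁅b⁆)

module _ {n} (G : Graph n) where

  adj-of-∈N : ∀ {v u} → u ∈ N G v → adj G v u ≡ true
  adj-of-∈N {v} {u} u∈N = trans (sym (lookup∘tabulate (adj G v) u)) ([]=⇒lookup u∈N)

  adj⇒≢ : ∀ {x y} → adj G x y ≡ true → x ≢ y
  adj⇒≢ {x} xy refl with trans (sym xy) (irrefl G x)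
  ... | ()

  ∉N-self : ∀ v → v ∉ N G v
  ∉N-self v v∈N = adj⇒≢ (adj-of-∈N v∈N) refl

  adj-sym : ∀ {x y} → adj G x y ≡ true → adj G y x ≡ true
  adj-sym {x} {y} xy = trans (Graph.sym G y x) xy

  triangle⇒cycle : ∀ {a b c} → adj G a b ≡ true → adj G b c ≡ true → adj G c a ≡ true → HasCycle G
  triangle⇒cycle {a} {b} {c} ab bc ca = 0 , lookup (a ∷ b ∷ c ∷ []) , lookup-injective distinct _ _ , walk , ca
    where
    distinct : Unique (a ∷ b ∷ c ∷ [])
    distinct = (adj⇒≢ ab ∷ (adj⇒≢ ca ∘ sym) ∷ []) ∷ (adj⇒≢ bc ∷ []) ∷ [] ∷ []
    walk : Walk G (lookup (a ∷ b ∷ c ∷ []))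
    walk zero       = ab
    walk (suc zero) = bc

  square⇒cycle : ∀ {a b c d} → a ≢ c → b ≢ d →
    adj G a b ≡ true → adj G b c ≡ true → adj G c d ≡ true → adj G d a ≡ true → HasCycle G
  square⇒cycle {a} {b} {c} {d} a≢c b≢d ab bc cd da =
    1 , lookup (a ∷ b ∷ c ∷ d ∷ []) , lookup-injective distinct _ _ , walk , da
    where
    distinct : Unique (a ∷ b ∷ c ∷ d ∷ [])
    distinct = (adj⇒≢ ab ∷ a≢c ∷ (adj⇒≢ da ∘ sym) ∷ []) ∷ (adj⇒≢ bc ∷ b≢d ∷ []) ∷ (adj⇒≢ cd ∷ []) ∷ [] ∷ []
    walk : Walk G (lookup (a ∷ b ∷ c ∷ d ∷ []))
    walk zero             = ab
    walk (suc zero)       = bc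
    walk (suc (suc zero)) = cd

  co2plex-of-unique-neighbour : ∀ {S} →
    (∀ {x y z} → x ∈ S → y ∈ S ∩ N G x → z ∈ S ∩ N G x → y ≡ z) → IsCo2Plex G S
  co2plex-of-unique-neighbour {S} unique x x∈S with nonempty? (S ∩ N G x)
  ... | no  empty      = subst (λ T → ∣ T ∣ ℕ.≤ 1) (sym (Empty-unique empty)) (ℕ.m≤n⇒m≤1+n (ℕ.≤-reflexive (∣⊥∣≡0 n)))
  ... | yes (y , y∈SN) = ℕ.≤-trans (p⊆q⇒∣p∣≤∣q∣ (λ z∈SN → subst (_∈ ⁅ y ⁆) (unique x∈S y∈SN z∈SN) (x∈⁅x⁆ y)))
                                   (ℕ.≤-reflexive (∣⁅x⁆∣≡1 y))

  pair-co2plex : ∀ a b → IsCo2Plex G (⁅ a ⁆ ∪ ⁅ b ⁆)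
  pair-co2plex a b = co2plex-of-unique-neighbour λ x∈ y∈ z∈ →
    other (∈pair x∈) (∈pair (proj₁ (x∈p∩q⁻ _ _ y∈))) (∈pair (proj₁ (x∈p∩q⁻ _ _ z∈)))
          (adj⇒≢ (adj-of-∈N (proj₂ (x∈p∩q⁻ _ _ y∈)))) (adj⇒≢ (adj-of-∈N (proj₂ (x∈p∩q⁻ _ _ z∈))))
    where
    other : ∀ {x y z} → x ≡ a ⊎ x ≡ b → y ≡ a ⊎ y ≡ b → z ≡ a ⊎ z ≡ b → x ≢ y → x ≢ z → y ≡ z
    other _           (inj₁ refl) (inj₁ refl) _   _   = refl
    other _           (inj₂ refl) (inj₂ refl) _   _   = refl
    other (inj₁ refl) (inj₁ refl) (inj₂ refl) x≢y _   = ⊥-elim (x≢y refl)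
    other (inj₂ refl) (inj₁ refl) (inj₂ refl) _   x≢z = ⊥-elim (x≢z refl)
    other (inj₁ refl) (inj₂ refl) (inj₁ refl) _   x≢z = ⊥-elim (x≢z refl)
    other (inj₂ refl) (inj₂ refl) (inj₁ refl) x≢y _   = ⊥-elim (x≢y refl)

  χ∈InP : ∀ {S} → IsCo2Plex G S → InP G (χ S)
  χ∈InP {S} co2 = 1 , (λ _ → 1ℚ) , (λ _ → S) , (λ _ → nonNegative⁻¹ 1ℚ) , refl , (λ _ → co2) ,
    (λ u → sym (trans (+-identityʳ _) (*-identityˡ _)))

  valid-of-co2plexes : ∀ (a : Point n) (b : ℚ) → (∀ S → IsCo2Plex G S → dot a (χ S) ≤ b) → Valid (InP G) a b
  valid-of-co2plexes a b bound x (m , c , S , c≥0 , Σc≡1 , co2 , x≡) = begin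
    dot a x                               ≡⟨ sumFin-cong (λ u → cong (a u *_) (x≡ u)) ⟩
    dot a (combination c (χ ∘ S))         ≡⟨ dot-combination a c (χ ∘ S) ⟩
    sumFin (λ i → c i * dot a (χ (S i)))  ≤⟨ sumFin-mono-≤ (λ i → *-monoˡ-≤-nonNeg (c i) {{nonNegative (c≥0 i)}}
                                                                (bound (S i) (co2 i))) ⟩
    sumFin (λ i → c i * b)                ≡⟨ sumFin-*ʳ b c ⟩
    sumFin c * b                          ≡⟨ cong (_* b) Σc≡1 ⟩
    1ℚ * b                                ≡⟨ *-identityˡ b ⟩
    b                                     ∎
    where open ≤-Reasoning

  unitSet : Fin (suc n) → Subset n
  unitSet zero    = ∅
  unitSet (suc u) = ⁅ u ⁆

  unitSet-co2plex : ∀ i → IsCo2Plex G (unitSet i)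
  unitSet-co2plex zero    = co2plex-of-unique-neighbour λ x∈∅ → ⊥-elim (∉⊥ x∈∅)
  unitSet-co2plex (suc u) = co2plex-of-unique-neighbour λ _ y∈ z∈ → trans (≡u y∈) (sym (≡u z∈))
    where
    ≡u : ∀ {x y} → y ∈ ⁅ u ⁆ ∩ N G x → y ≡ u
    ≡u y∈ = x∈⁅y⁆⇒x≡y u (proj₁ (x∈p∩q⁻ _ _ y∈))

  unitSet-affinelyIndependent : AffinelyIndependent (χ ∘ unitSet)
  unitSet-affinelyIndependent c Σc≡0 rel = c≡0
    where
    c-suc≡0 : ∀ u → c (suc u) ≡ 0ℚ
    c-suc≡0 u = isolated-coefficient≡0 c (λ i → χ (unitSet i) u) (suc u) (rel u) (χ-∈ (x∈⁅x⁆ u)) others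
      where
      others : ∀ i → i ≢ suc u → c i * χ (unitSet i) u ≡ 0ℚ
      others zero    _     = trans (cong (c zero *_) (χ-∉ {S = ∅} {u} ∉⊥)) (*-zeroʳ (c zero))
      others (suc v) sv≢su = trans (cong (c (suc v) *_) (χ-∉ (x≢y⇒x∉⁅y⁆ (sv≢su ∘ cong suc ∘ sym)))) (*-zeroʳ (c (suc v)))
    c≡0 : ∀ i → c i ≡ 0ℚ
    c≡0 zero    = isolated-coefficient≡0 c (λ _ → 1ℚ) zero
      (trans (sumFin-cong (λ i → *-identityʳ (c i))) Σc≡0) refl
      (λ { zero 0≢0 → ⊥-elim (0≢0 refl) ; (suc u) _ → trans (cong (_* 1ℚ) (c-suc≡0 u)) (*-zeroˡ 1ℚ) })
    c≡0 (suc u) = c-suc≡0 u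

  P-hasDim : HasDim (InP G) n
  P-hasDim = hasDim-full {X = InP G} (χ ∘ unitSet , (λ i → χ∈InP (unitSet-co2plex i)) , unitSet-affinelyIndependent)

module _ {n} (w : Fin n) (r : ℚ) where

  indicator-off : ∀ {u} → u ≢ w → (if isYes (u Fin.≟ w) then r else 0ℚ) ≡ 0ℚ
  indicator-off {u} u≢w with u Fin.≟ w
  ... | yes u≡w = ⊥-elim (u≢w u≡w)
  ... | no  _   = refl

  indicator-at : (if isYes (w Fin.≟ w) then r else 0ℚ) ≡ r
  indicator-at with w Fin.≟ w
  ... | yes _   = refl
  ... | no  w≢w = ⊥-elim (w≢w refl)

starCoeff-dot : ∀ {n} (W : Subset n) (w : Fin n) (x : Point n) →
  dot (starCoeff W w) x ≡ xOf x W + (card W - 1ℚ) * x w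
starCoeff-dot W w x = begin
  sumFin (λ u → (χ W u + δ u) * x u)
    ≡⟨ sumFin-cong (λ u → solve 3 (λ χ δ x → (χ :+ δ) :* x := x :* χ :+ δ :* x) refl (χ W u) (δ u) (x u)) ⟩
  sumFin (λ u → x u * χ W u + δ u * x u)
    ≡⟨ sumFin-+ (λ u → x u * χ W u) (λ u → δ u * x u) ⟩
  xOf x W + sumFin (λ u → δ u * x u)
    ≡⟨ cong (xOf x W +_) (sumFin-single (λ u → δ u * x u) w λ u u≢w →
         trans (cong (_* x u) (indicator-off w (card W - 1ℚ) u≢w)) (*-zeroˡ (x u))) ⟩
  xOf x W + δ w * x w
    ≡⟨ cong (λ t → xOf x W + t * x w) (indicator-at w (card W - 1ℚ)) ⟩
  xOf x W + (card W - 1ℚ) * x w ∎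
  where
  open ≡-Reasoning
  δ : Fin _ → ℚ
  δ u = if isYes (u Fin.≟ w) then card W - 1ℚ else 0ℚ

starCoeff-dot-χ : ∀ {n} (W S : Subset n) (w : Fin n) →
  dot (starCoeff W w) (χ S) ≡ fromℕ ∣ S ∩ W ∣ + (card W - 1ℚ) * χ S w
starCoeff-dot-χ W S w = trans (starCoeff-dot W w (χ S)) (cong (_+ (card W - 1ℚ) * χ S w) (xOf-χ S W))

module Star {n} (G : Graph n) (w : Fin n) (W : Subset n) (W⊆N : W ⊆ N G w) where

  w∉W : w ∉ W
  w∉W = ∉N-self G w ∘ W⊆N

  ∈W⇒≢w : ∀ {u} → u ∈ W → u ≢ w
  ∈W⇒≢w u∈W refl = w∉W u∈W

  starCoeff-centre : starCoeff W w w ≡ card W - 1ℚ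
  starCoeff-centre = trans (cong₂ _+_ (χ-∉ w∉W) (indicator-at w (card W - 1ℚ))) (+-identityˡ _)

  starCoeff-leaf : ∀ {u} → u ∈ W → starCoeff W w u ≡ 1ℚ
  starCoeff-leaf u∈W = trans (cong₂ _+_ (χ-∈ u∈W) (indicator-off w (card W - 1ℚ) (∈W⇒≢w u∈W))) (+-identityʳ 1ℚ)

  starCoeff-nonzero : ∃ λ j → starCoeff W w j ≢ 0ℚ
  starCoeff-nonzero with nonempty? W
  ... | yes (u , u∈W) = u , λ aᵤ≡0 → 1≢0 (trans (sym (starCoeff-leaf u∈W)) aᵤ≡0)
  ... | no  empty     = w , λ a_w≡0 → -1≢0 (trans (cong (_- 1ℚ) (sym card≡0)) (trans (sym starCoeff-centre) a_w≡0))
    where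
    -1≢0 : 0ℚ - 1ℚ ≢ 0ℚ
    -1≢0 ()
    card≡0 : card W ≡ 0ℚ
    card≡0 = trans (cong card (Empty-unique empty)) (cong (λ k → ℤ.+ k / 1) (∣⊥∣≡0 n))

  value-∈ : ∀ {S} → w ∈ S → dot (starCoeff W w) (χ S) ≡ fromℕ ∣ S ∩ W ∣ + (card W - 1ℚ)
  value-∈ {S} w∈S = trans (starCoeff-dot-χ W S w)
    (cong (fromℕ ∣ S ∩ W ∣ +_) (trans (cong ((card W - 1ℚ) *_) (χ-∈ w∈S)) (*-identityʳ (card W - 1ℚ))))

  value-∉ : ∀ {S} → w ∉ S → dot (starCoeff W w) (χ S) ≡ fromℕ ∣ S ∩ W ∣
  value-∉ {S} w∉S = trans (starCoeff-dot-χ W S w)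
    (trans (cong (fromℕ ∣ S ∩ W ∣ +_) (trans (cong ((card W - 1ℚ) *_) (χ-∉ w∉S)) (*-zeroʳ (card W - 1ℚ)))) (+-identityʳ (fromℕ ∣ S ∩ W ∣)))

  1+[K-1]≡K : 1ℚ + (card W - 1ℚ) ≡ card W
  1+[K-1]≡K = solve 1 (λ K → con 1ℚ :+ (K :- con 1ℚ) := K) refl (card W)

  star-valid-χ : ∀ {S} → IsCo2Plex G S → dot (starCoeff W w) (χ S) ≤ card W
  star-valid-χ {S} co2 with w ∈? S
  ... | yes w∈S = begin
    dot (starCoeff W w) (χ S)        ≡⟨ value-∈ w∈S ⟩
    fromℕ ∣ S ∩ W ∣ + (card W - 1ℚ)  ≤⟨ +-monoˡ-≤ (card W - 1ℚ) (fromℕ-mono-≤ ∣S∩W∣≤1) ⟩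
    1ℚ + (card W - 1ℚ)               ≡⟨ 1+[K-1]≡K ⟩
    card W                           ∎
    where
    open ≤-Reasoning
    S∩W⊆S∩N : S ∩ W ⊆ S ∩ N G w
    S∩W⊆S∩N u∈S∩W = let (u∈S , u∈W) = x∈p∩q⁻ S W u∈S∩W in x∈p∩q⁺ (u∈S , W⊆N u∈W)
    ∣S∩W∣≤1 : ∣ S ∩ W ∣ ℕ.≤ 1
    ∣S∩W∣≤1 = ℕ.≤-trans (p⊆q⇒∣p∣≤∣q∣ S∩W⊆S∩N) (co2 w w∈S)
  ... | no w∉S = begin
    dot (starCoeff W w) (χ S)  ≡⟨ value-∉ w∉S ⟩
    fromℕ ∣ S ∩ W ∣            ≤⟨ fromℕ-mono-≤ (∣p∩q∣≤∣q∣ S W) ⟩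
    fromℕ ∣ W ∣                ≡⟨ sym (+k/1≡fromℕ ∣ W ∣) ⟩
    card W                     ∎
    where open ≤-Reasoning

  star-valid : Valid (InP G) (starCoeff W w) (card W)
  star-valid = valid-of-co2plexes G (starCoeff W w) (card W) (λ S → star-valid-χ)

  star-tight-∈ : ∀ {S} → w ∈ S → ∣ S ∩ W ∣ ≡ 1 → dot (starCoeff W w) (χ S) ≡ card W
  star-tight-∈ w∈S ∣S∩W∣≡1 = trans (value-∈ w∈S) (trans (cong (λ k → fromℕ k + (card W - 1ℚ)) ∣S∩W∣≡1) 1+[K-1]≡K)

  star-tight-∉ : ∀ {S} → w ∉ S → ∣ S ∩ W ∣ ≡ ∣ W ∣ → dot (starCoeff W w) (χ S) ≡ card W
  star-tight-∉ w∉S ∣S∩W∣≡∣W∣ = trans (value-∉ w∉S) (trans (cong fromℕ ∣S∩W∣≡∣W∣) (sym (+k/1≡fromℕ ∣ W ∣)))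

module StarFacet {d} (G : Graph (suc d)) (acyclic : ¬ HasCycle G)
                 (w : Fin (suc d)) (W : Subset (suc d)) (W⊆N : W ⊆ N G w) where
  open Star G w W W⊆N

  V : Set
  V = Fin (suc d)

  W-independent : ∀ {x y} → x ∈ W → y ∈ W → y ∉ N G x
  W-independent x∈W y∈W y∈Nx =
    acyclic (triangle⇒cycle G (adj-of-∈N G (W⊆N x∈W)) (adj-of-∈N G y∈Nx) (adj-sym G (adj-of-∈N G (W⊆N y∈W))))

  faceSet : V → Subset (suc d)
  faceSet v with v Fin.≟ w | v ∈? W
  ... | yes _ | _     = W
  ... | no  _ | yes _ = ⁅ w ⁆ ∪ ⁅ v ⁆
  ... | no  _ | no  _ = W ∪ ⁅ v ⁆

  data Role (v : V) : Set where
    centre : v ≡ w → Role v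
    leaf   : v ∈ W → Role v
    outer  : v ≢ w → v ∉ W → Role v

  role : ∀ v → Role v
  role v with v Fin.≟ w | v ∈? W
  ... | yes v≡w | _        = centre v≡w
  ... | no  _   | yes v∈W  = leaf v∈W
  ... | no  v≢w | no  v∉W  = outer v≢w v∉W

  faceSet-centre : faceSet w ≡ W
  faceSet-centre with w Fin.≟ w | w ∈? W
  ... | yes _   | _ = refl
  ... | no  w≢w | _ = ⊥-elim (w≢w refl)

  faceSet-leaf : ∀ {v} → v ∈ W → faceSet v ≡ ⁅ w ⁆ ∪ ⁅ v ⁆
  faceSet-leaf {v} v∈W with v Fin.≟ w | v ∈? W
  ... | yes refl | _       = ⊥-elim (w∉W v∈W)
  ... | no  _    | yes _   = refl
  ... | no  _    | no  v∉W = ⊥-elim (v∉W v∈W)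

  faceSet-outer : ∀ {v} → v ≢ w → v ∉ W → faceSet v ≡ W ∪ ⁅ v ⁆
  faceSet-outer {v} v≢w v∉W with v Fin.≟ w | v ∈? W
  ... | yes v≡w | _       = ⊥-elim (v≢w v≡w)
  ... | no  _   | yes v∈W = ⊥-elim (v∉W v∈W)
  ... | no  _   | no  _   = refl

  outer-co2plex : ∀ {v} → v ≢ w → IsCo2Plex G (W ∪ ⁅ v ⁆)
  outer-co2plex {v} v≢w = co2plex-of-unique-neighbour G unique
    where
    parts : ∀ {x y} → y ∈ (W ∪ ⁅ v ⁆) ∩ N G x → (y ∈ W ⊎ y ≡ v) × y ∈ N G x
    parts y∈ with x∈p∩q⁻ (W ∪ ⁅ v ⁆) _ y∈
    ... | y∈S , y∈N with x∈p∪q⁻ W ⁅ v ⁆ y∈S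
    ...   | inj₁ y∈W = inj₁ y∈W , y∈N
    ...   | inj₂ y∈v = inj₂ (x∈⁅y⁆⇒x≡y v y∈v) , y∈N

    neighbour-of-W≡v : ∀ {x y} → x ∈ W → y ∈ (W ∪ ⁅ v ⁆) ∩ N G x → y ≡ v
    neighbour-of-W≡v x∈W y∈ with parts y∈
    ... | inj₁ y∈W , y∈N = ⊥-elim (W-independent x∈W y∈W y∈N)
    ... | inj₂ y≡v , _   = y≡v

    neighbour-of-v∈W : ∀ {y} → y ∈ (W ∪ ⁅ v ⁆) ∩ N G v → y ∈ W
    neighbour-of-v∈W y∈ with parts y∈
    ... | inj₁ y∈W , _   = y∈W
    ... | inj₂ refl , y∈N = ⊥-elim (∉N-self G _ y∈N)

    unique : ∀ {x y z} → x ∈ W ∪ ⁅ v ⁆ → y ∈ (W ∪ ⁅ v ⁆) ∩ N G x → z ∈ (W ∪ ⁅ v ⁆) ∩ N G x → y ≡ z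
    unique {x} {y} {z} x∈ y∈ z∈ with x∈p∪q⁻ W ⁅ v ⁆ x∈
    ... | inj₁ x∈W = trans (neighbour-of-W≡v x∈W y∈) (sym (neighbour-of-W≡v x∈W z∈))
    ... | inj₂ x∈v with x∈⁅y⁆⇒x≡y v x∈v
    ...   | refl with y Fin.≟ z
    ...     | yes y≡z = y≡z
    ...     | no  y≢z = ⊥-elim (acyclic (square⇒cycle G (v≢w ∘ sym) y≢z
                  (adj-of-∈N G (W⊆N (neighbour-of-v∈W y∈))) (adj-sym G (adj-of-∈N G (proj₂ (parts y∈))))
                  (adj-of-∈N G (proj₂ (parts z∈))) (adj-sym G (adj-of-∈N G (W⊆N (neighbour-of-v∈W z∈))))))

  faceSet-co2plex : ∀ v → IsCo2Plex G (faceSet v)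
  faceSet-co2plex v with role v
  ... | centre refl rewrite faceSet-centre = co2plex-of-unique-neighbour G λ x∈W y∈ _ →
    ⊥-elim (W-independent x∈W (proj₁ (x∈p∩q⁻ W _ y∈)) (proj₂ (x∈p∩q⁻ W _ y∈)))
  ... | leaf v∈W        rewrite faceSet-leaf v∈W        = pair-co2plex G w v
  ... | outer v≢w v∉W   rewrite faceSet-outer v≢w v∉W   = outer-co2plex v≢w

  facePoint : V → Point (suc d)
  facePoint v = χ (faceSet v)

  pair∩W≡⁅leaf⁆ : ∀ {v} → v ∈ W → (⁅ w ⁆ ∪ ⁅ v ⁆) ∩ W ≡ ⁅ v ⁆
  pair∩W≡⁅leaf⁆ {v} v∈W = ⊆-antisym ⊆⁅v⁆ ⁅v⁆⊆
    where
    ⊆⁅v⁆ : (⁅ w ⁆ ∪ ⁅ v ⁆) ∩ W ⊆ ⁅ v ⁆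
    ⊆⁅v⁆ u∈ with x∈p∩q⁻ (⁅ w ⁆ ∪ ⁅ v ⁆) W u∈
    ... | u∈pair , u∈W with ∈pair u∈pair
    ...   | inj₁ refl = ⊥-elim (w∉W u∈W)
    ...   | inj₂ refl = x∈⁅x⁆ v
    ⁅v⁆⊆ : ⁅ v ⁆ ⊆ (⁅ w ⁆ ∪ ⁅ v ⁆) ∩ W
    ⁅v⁆⊆ u∈⁅v⁆ with x∈⁅y⁆⇒x≡y v u∈⁅v⁆
    ... | refl = x∈p∩q⁺ (x∈p∪q⁺ (inj₂ u∈⁅v⁆) , v∈W)

  facePoint-tight : ∀ v → dot (starCoeff W w) (facePoint v) ≡ card W
  facePoint-tight v with role v
  ... | centre refl rewrite faceSet-centre =
    star-tight-∉ w∉W (cong ∣_∣ (∩-idem W))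
  ... | leaf v∈W rewrite faceSet-leaf v∈W =
    star-tight-∈ (x∈p∪q⁺ (inj₁ (x∈⁅x⁆ w))) (trans (cong ∣_∣ (pair∩W≡⁅leaf⁆ v∈W)) (∣⁅x⁆∣≡1 v))
  ... | outer v≢w v∉W rewrite faceSet-outer v≢w v∉W =
    star-tight-∉ w∉W∪⁅v⁆ (cong ∣_∣ (trans (∩-comm (W ∪ ⁅ v ⁆) W) (∩-abs-∪ W ⁅ v ⁆)))
    where
    w∉W∪⁅v⁆ : w ∉ W ∪ ⁅ v ⁆
    w∉W∪⁅v⁆ w∈ with x∈p∪q⁻ W ⁅ v ⁆ w∈
    ... | inj₁ w∈W = w∉W w∈W
    ... | inj₂ w∈⁅v⁆ = v≢w (sym (x∈⁅y⁆⇒x≡y v w∈⁅v⁆))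

  ∈faceSet-self : ∀ {u} → u ≢ w → u ∈ faceSet u
  ∈faceSet-self {u} u≢w with role u
  ... | centre u≡w    = ⊥-elim (u≢w u≡w)
  ... | leaf u∈W      rewrite faceSet-leaf u∈W      = x∈p∪q⁺ (inj₂ (x∈⁅x⁆ u))
  ... | outer _ u∉W   rewrite faceSet-outer u≢w u∉W = x∈p∪q⁺ (inj₂ (x∈⁅x⁆ u))

  centre∈faceSet-leaf : ∀ {v} → v ∈ W → w ∈ faceSet v
  centre∈faceSet-leaf v∈W rewrite faceSet-leaf v∈W = x∈p∪q⁺ (inj₁ (x∈⁅x⁆ w))

  outer∉faceSet : ∀ {u v} → u ≢ w → u ∉ W → v ≢ u → u ∉ faceSet v
  outer∉faceSet {u} {v} u≢w u∉W v≢u with role v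
  ... | centre refl rewrite faceSet-centre = u∉W
  ... | leaf v∈W rewrite faceSet-leaf v∈W = λ u∈ → case ∈pair u∈ of λ where
    (inj₁ u≡w) → u≢w u≡w
    (inj₂ u≡v) → v≢u (sym u≡v)
  ... | outer v≢w v∉W rewrite faceSet-outer v≢w v∉W = λ u∈ → case x∈p∪q⁻ W ⁅ v ⁆ u∈ of λ where
    (inj₁ u∈W)  → u∉W u∈W
    (inj₂ u∈⁅v⁆) → v≢u (sym (x∈⁅y⁆⇒x≡y v u∈⁅v⁆))

  leaf∉faceSet-leaf : ∀ {u v} → u ∈ W → v ∈ W → v ≢ u → u ∉ faceSet v
  leaf∉faceSet-leaf u∈W v∈W v≢u rewrite faceSet-leaf v∈W = λ u∈ → case ∈pair u∈ of λ where
    (inj₁ u≡w) → ∈W⇒≢w u∈W u≡w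
    (inj₂ u≡v) → v≢u (sym u≡v)

  facePoint-affinelyIndependent : AffinelyIndependent facePoint
  facePoint-affinelyIndependent c Σc≡0 rel = c≡0
    where
    term≡0-∉ : ∀ {v u} → u ∉ faceSet v → c v * facePoint v u ≡ 0ℚ
    term≡0-∉ {v} u∉ = trans (cong (c v *_) (χ-∉ u∉)) (*-zeroʳ (c v))

    term≡0-c≡0 : ∀ {v} (f : ℚ) → c v ≡ 0ℚ → c v * f ≡ 0ℚ
    term≡0-c≡0 f cᵥ≡0 = trans (cong (_* f) cᵥ≡0) (*-zeroˡ f)

    c-outer≡0 : ∀ {u} → u ≢ w → u ∉ W → c u ≡ 0ℚ
    c-outer≡0 {u} u≢w u∉W = isolated-coefficient≡0 c (λ v → facePoint v u) u (rel u) (χ-∈ (∈faceSet-self u≢w))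
      (λ v v≢u → term≡0-∉ (outer∉faceSet u≢w u∉W v≢u))

    -- Apply the relation to the affine function 1 - x_w: it vanishes on the leaves' points,
    -- and the outer coefficients are already known to be 0.
    c-centre≡0 : c w ≡ 0ℚ
    c-centre≡0 = isolated-coefficient≡0 c (λ v → 1ℚ - facePoint v w) w Σ≡0 f-w≡1 others
      where
      Σ≡0 : sumFin (λ v → c v * (1ℚ - facePoint v w)) ≡ 0ℚ
      Σ≡0 = begin
        sumFin (λ v → c v * (1ℚ - facePoint v w))
          ≡⟨ sumFin-cong (λ v → solve 2 (λ c q → c :* (con 1ℚ :- q) := c :+ :- con 1ℚ :* (c :* q)) refl (c v) (facePoint v w)) ⟩
        sumFin (λ v → c v + - 1ℚ * (c v * facePoint v w))
          ≡⟨ sumFin-+ c (λ v → - 1ℚ * (c v * facePoint v w)) ⟩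
        sumFin c + sumFin (λ v → - 1ℚ * (c v * facePoint v w))
          ≡⟨ cong (sumFin c +_) (sumFin-*ˡ (- 1ℚ) (λ v → c v * facePoint v w)) ⟩
        sumFin c + - 1ℚ * combination c facePoint w
          ≡⟨ cong₂ (λ s t → s + - 1ℚ * t) Σc≡0 (rel w) ⟩
        0ℚ + - 1ℚ * 0ℚ
          ≡⟨⟩
        0ℚ ∎
        where open ≡-Reasoning
      f-w≡1 : 1ℚ - facePoint w w ≡ 1ℚ
      f-w≡1 = cong (λ t → 1ℚ - t) (trans (cong (λ S → χ S w) faceSet-centre) (χ-∉ w∉W))
      others : ∀ v → v ≢ w → c v * (1ℚ - facePoint v w) ≡ 0ℚ
      others v v≢w with role v
      ... | centre v≡w    = ⊥-elim (v≢w v≡w)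
      ... | leaf v∈W      = trans (cong (λ t → c v * (1ℚ - t)) (χ-∈ (centre∈faceSet-leaf v∈W))) (*-zeroʳ (c v))
      ... | outer _ v∉W   = term≡0-c≡0 (1ℚ - facePoint v w) (c-outer≡0 v≢w v∉W)

    c-leaf≡0 : ∀ {u} → u ∈ W → c u ≡ 0ℚ
    c-leaf≡0 {u} u∈W = isolated-coefficient≡0 c (λ v → facePoint v u) u (rel u) (χ-∈ (∈faceSet-self (∈W⇒≢w u∈W))) others
      where
      others : ∀ v → v ≢ u → c v * facePoint v u ≡ 0ℚ
      others v v≢u with role v
      ... | centre refl   = term≡0-c≡0 (facePoint v u) c-centre≡0
      ... | leaf v∈W      = term≡0-∉ (leaf∉faceSet-leaf u∈W v∈W v≢u)
      ... | outer v≢w v∉W = term≡0-c≡0 (facePoint v u) (c-outer≡0 v≢w v∉W)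

    c≡0 : ∀ v → c v ≡ 0ℚ
    c≡0 v with role v
    ... | centre refl   = c-centre≡0
    ... | leaf v∈W      = c-leaf≡0 v∈W
    ... | outer v≢w v∉W = c-outer≡0 v≢w v∉W

  Face : Point (suc d) → Set
  Face x = InP G x × dot (starCoeff W w) x ≡ card W

  definesFacet : DefinesFacet (InP G) (starCoeff W w) (card W)
  definesFacet = star-valid , d , P-hasDim G ,
    hasDim-hyperplane {X = Face} (starCoeff W w) (card W) (proj₁ starCoeff-nonzero) (proj₂ starCoeff-nonzero) (λ _ → proj₂)
      (facePoint , (λ v → χ∈InP G (faceSet-co2plex v) , facePoint-tight v) , facePoint-affinelyIndependent)

star-definesFacet : ∀ {n} (G : Graph n) → ¬ HasCycle G → ∀ w W → W ⊆ N G w →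
  DefinesFacet (InP G) (starCoeff W w) (card W)
star-definesFacet {suc d} G acyclic w W W⊆N = StarFacet.definesFacet G acyclic w W W⊆N

corollary4 : ∀ {n} (G : Graph n) →
    (∀ (w : Fin n) (W : Subset n) → W ⊆ N G w →
      Valid (InP G) (starCoeff W w) (card W))
    × (IsTree G → ∀ (w : Fin n) (W : Subset n) → W ⊆ N G w →
      DefinesFacet (InP G) (starCoeff W w) (card W))
corollary4 G = (λ w W W⊆N → Star.star-valid G w W W⊆N) , (λ tree → star-definesFacet G (proj₂ tree))
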